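{- If $\Gamma\vdash M_1$ is derivable and $M_1\rightarrow M_2$, then $\Gamma\vdash M_2$ is derivable. If $\Gamma\vdash s_1\triangleright\Delta$ is derivable and $s_1\rightarrow s_2$, then $\Gamma\vdash s_2\triangleright\Delta$ is derivable.
   Context: Calculus $\lambda\pi$. Terms and substitutions: $M,N::= a\mid MN\mid\lambda a.M\mid s\circ M$ and $s,q::= id\mid\pi_a\mid\langle s\,,\,N\backslash a\rangle\mid s\circ q$, where $a,b$ range over variables; $\langle s\,,\,N\backslash a\rangle$ is the substitution $s$ extended by "$N$ for $a$", $s\circ M$ is $M$ under the explicit substitution $s$, $\pi_a$ is a shift. Conventions: $s\circ q\circ M$ means $s\circ(q\circ M)$, $s\circ q\circ r$ means $s\circ(q\circ r)$, $s\circ MN$ means $s\circ(MN)$. Contexts are finite lists of variables with repetitions allowed. Derivable judgements $\Gamma\vdash M$ and $\Gamma\vdash s\triangleright\Delta$ are generated by: (i) $\Gamma,a\vdash a$; (ii) from $\Gamma\vdash a$ infer $\Gamma,b\vdash a$ ($a\neq b$); (iii) from $\Gamma\vdash M$, $\Gamma\vdash N$ infer $\Gamma\vdash MN$; (iv) from $\Gamma,a\vdash M$ infer $\Gamma\vdash\lambda a.M$; (v) from $\Gamma\vdash s\triangleright\Delta$, $\Delta\vdash M$ infer $\Gamma\vdash s\circ M$; (vi) $\Gamma\vdash id\triangleright\Gamma$; (vii) $\Gamma,a\vdash\pi_a\triangleright\Gamma$; (viii) from $\Gamma\vdash s\triangleright\Delta$, $\Gamma\vdash N$ infer $\Gamma\vdash\langle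 s\,,\,N\backslash a\rangle\triangleright\Delta,a$; (ix) from $\Gamma\vdash s\triangleright\Delta$, $\Delta\vdash q\triangleright\Sigma$ infer $\Gamma\vdash s\circ q\triangleright\Sigma$. The one-step reduction $\rightarrow$ on terms and substitutions is the compatible closure of: (Beta) $(\lambda a.M)N\rightarrow\langle id\,,\,N\backslash a\rangle\circ M$; (Abs) $s\circ\lambda a.M\rightarrow\lambda a.\langle\pi_a\circ s\,,\,a\backslash a\rangle\circ M$; (App) $s\circ MN\rightarrow(s\circ M)(s\circ N)$; (ConsVar) $\langle s\,,\,N\backslash a\rangle\circ a\rightarrow N$; (New) $\langle s\,,\,N\backslash a\rangle\circ b\rightarrow s\circ b$ ($a\neq b$); (IdVar) $id\circ a\rightarrow a$; (Clos) $s\circ q\circ M\rightarrow(s\circ q)\circ M$; (Ass) $s\circ q\circ r\rightarrow(s\circ q)\circ r$; (IdR) $s\circ id\rightarrow s$; (IdShift) $id\circ\pi_a\rightarrow\pi_a$; (ConsShift) $\langle s\,,\,N\backslash a\rangle\circ\pi_a\rightarrow s$; (Map) $s\circ\langle q\,,\,N\backslash a\rangle\rightarrow\langle s\circ q\,,\,s\circ N\backslash a\rangle$; ($\pi_1$) $\pi_a\circ b\rightarrow b$ ($a\neq b$); ($\pi_2$) $(s\circ\pi_a)\circ b\rightarrow s\circ b$ ($a\neq b$); ($\alpha_1$) $\lambda a.M\rightarrow\lambda b.\langle\pi_b\,,\,b\backslash a\rangle\circ M$ (under a side condition on free variables: $a$ free in $\lambda a.M$, $b$ not). -}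

module Defs where

open import Data.Nat using (ℕ)
open import Data.Nat.Properties using (_≟_)
open import Data.List using (List; []; _∷_; _++_; filter)
open import Data.List.Membership.DecPropositional _≟_ using (_∈_; _∉_; _∈?_)
open import Relation.Nullary using (¬_; does)
open import Relation.Binary.PropositionalEquality using (_≡_; _≢_)
open import Data.Bool using (if_then_else_)

-- Variables are natural numbers (any countable set with decidable equality).
Var : Set
Var = ℕ

mutual
  data Term : Set where
    var  : Var → Term
    app  : Term → Term → Term
    lam  : Var → Term → Term
    clos : Subst → Term → Term

  data Subst : Set where
    id    : Subst
    shift : Var → Subst
    cons  : Subst → Term → Var → Subst
    comp  : Subst → Subst → Subst

-- Contexts: finite lists of variables with repetitions, the rightmost
-- element being the most recently added one.  Γ , a  is  snoc Γ a.
data Ctx : Set where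
  ε   : Ctx
  _,_ : Ctx → Var → Ctx

infixl 5 _,_

mutual
  data _⊢_ : Ctx → Term → Set where
    ax   : ∀ {Γ a} → (Γ , a) ⊢ var a
    weak : ∀ {Γ a b} → Γ ⊢ var a → a ≢ b → (Γ , b) ⊢ var a
    tapp : ∀ {Γ M N} → Γ ⊢ M → Γ ⊢ N → Γ ⊢ app M N
    tlam : ∀ {Γ a M} → (Γ , a) ⊢ M → Γ ⊢ lam a M
    tclo : ∀ {Γ Δ s M} → Γ ⊢ s ▷ Δ → Δ ⊢ M → Γ ⊢ clos s M

  data _⊢_▷_ : Ctx → Subst → Ctx → Set where
    tid    : ∀ {Γ} → Γ ⊢ id ▷ Γ
    tshift : ∀ {Γ a} → (Γ , a) ⊢ shift a ▷ Γ
    tcons  : ∀ {Γ Δ s N a} → Γ ⊢ s ▷ Δ → Γ ⊢ N → Γ ⊢ cons s N a ▷ (Δ , a)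
    tcomp  : ∀ {Γ Δ Σ s q} → Γ ⊢ s ▷ Δ → Δ ⊢ q ▷ Σ → Γ ⊢ comp s q ▷ Σ

infix 4 _⊢_ _⊢_▷_

remove : Var → List Var → List Var
remove a xs = filter (λ x → ¬? (x ≟ a)) xs
  where open import Relation.Nullary using (¬?)

mutual
  fv : Term → List Var
  fv (var a)    = a ∷ []
  fv (app M N)  = fv M ++ fv N
  fv (lam a M)  = remove a (fv M)
  fv (clos s M) = fvS s (fv M)

  -- fvS s X : free variables of  s ∘ M  when the free variables of M are X.
  fvS : Subst → List Var → List Var
  fvS id          X = X
  fvS (shift a)   X = X
  fvS (cons s N a) X =
    (if does (a ∈? X) then fv N else []) ++ fvS s (remove a X)
  fvS (comp s q)  X = fvS s (fvS q X)

mutual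
  data _⟶_ : Term → Term → Set where
    Beta    : ∀ {a M N} → app (lam a M) N ⟶ clos (cons id N a) M
    Abs     : ∀ {s a M} →
              clos s (lam a M) ⟶ lam a (clos (cons (comp (shift a) s) (var a) a) M)
    App     : ∀ {s M N} → clos s (app M N) ⟶ app (clos s M) (clos s N)
    ConsVar : ∀ {s N a} → clos (cons s N a) (var a) ⟶ N
    New     : ∀ {s N a b} → a ≢ b → clos (cons s N a) (var b) ⟶ clos s (var b)
    IdVar   : ∀ {a} → clos id (var a) ⟶ var a
    Clos    : ∀ {s q M} → clos s (clos q M) ⟶ clos (comp s q) M
    π₁      : ∀ {a b} → a ≢ b → clos (shift a) (var b) ⟶ var b
    π₂      : ∀ {s a b} → a ≢ b → clos (comp s (shift a)) (var b) ⟶ clos s (var b)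
    α₁      : ∀ {a b M} → b ∉ fv (lam a M) →
              lam a M ⟶ lam b (clos (cons (shift b) (var b) a) M)
    appL    : ∀ {M M' N} → M ⟶ M' → app M N ⟶ app M' N
    appR    : ∀ {M N N'} → N ⟶ N' → app M N ⟶ app M N'
    lamC    : ∀ {a M M'} → M ⟶ M' → lam a M ⟶ lam a M'
    closL   : ∀ {s s' M} → s ⟶ₛ s' → clos s M ⟶ clos s' M
    closR   : ∀ {s M M'} → M ⟶ M' → clos s M ⟶ clos s M'

  data _⟶ₛ_ : Subst → Subst → Set where
    Ass       : ∀ {s q r} → comp s (comp q r) ⟶ₛ comp (comp s q) r
    IdR       : ∀ {s} → comp s id ⟶ₛ s
    IdShift   : ∀ {a} → comp id (shift a) ⟶ₛ shift a
    ConsShift : ∀ {s N a} → comp (cons s N a) (shift a) ⟶ₛ s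
    Map       : ∀ {s q N a} → comp s (cons q N a) ⟶ₛ cons (comp s q) (clos s N) a
    consL     : ∀ {s s' N a} → s ⟶ₛ s' → cons s N a ⟶ₛ cons s' N a
    consR     : ∀ {s N N' a} → N ⟶ N' → cons s N a ⟶ₛ cons s N' a
    compL     : ∀ {s s' q} → s ⟶ₛ s' → comp s q ⟶ₛ comp s' q
    compR     : ∀ {s q q'} → q ⟶ₛ q' → comp s q ⟶ₛ comp s q'

infix 3 _⟶_ _⟶ₛ_

module Submission where

--  * For a contraction at the root, the typing derivation of the redex is
--    inverted one or two levels deep (by pattern matching on it) and its
--    components are reassembled into a derivation of the contractum.  The
--    only non-trivial bookkeeping concerns variables: the rules New, π₁ and
--    π₂ move a variable b across a binder a ≢ b, which needs the two facts
--    below on typing variables in an extended context.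
--  * For a step inside a subterm (the compatible-closure rules), the typing
--    rule of the enclosing constructor is reapplied to the derivation given
--    by the induction hypothesis for the reduced component.

open import Defs
open import Data.Product using (_×_) renaming (_,_ to _,,_)
open import Data.Empty using (⊥-elim)
open import Relation.Binary.PropositionalEquality using (refl; _≢_; ≢-sym)

-- Weakening for variables: a variable typed in Γ stays typed when a
-- different variable a is pushed on top (rule (ii), hypothesis flipped to
-- match the side conditions of π₁ and π₂).
weakenVar : ∀ {Γ a b} → Γ ⊢ var b → a ≢ b → (Γ , a) ⊢ var b
weakenVar v a≢b = weak v (≢-sym a≢b)

-- Strengthening for variables: if b ≢ a is typed in Γ , a, then its typing
-- does not use the top entry a, so b is already typed in Γ (needed by New).
strengthenVar : ∀ {Γ a b} → (Γ , a) ⊢ var b → a ≢ b → Γ ⊢ var b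
strengthenVar ax         a≢a = ⊥-elim (a≢a refl)
strengthenVar (weak v _) _   = v

mutual
  preservation : ∀ {Γ M₁ M₂} → Γ ⊢ M₁ → M₁ ⟶ M₂ → Γ ⊢ M₂
  preservation (tapp (tlam m) n)          Beta      = tclo (tcons tid n) m
  preservation (tclo s (tlam m))          Abs       = tlam (tclo (tcons (tcomp tshift s) ax) m)
  preservation (tclo s (tapp m n))        App       = tapp (tclo s m) (tclo s n)
  preservation (tclo (tcons s n) _)       ConsVar   = n
  preservation (tclo (tcons s n) v)       (New a≢b) = tclo s (strengthenVar v a≢b)
  preservation (tclo tid v)               IdVar     = v
  preservation (tclo s (tclo q m))        Clos      = tclo (tcomp s q) m
  preservation (tclo tshift v)            (π₁ a≢b)  = weakenVar v a≢b
  preservation (tclo (tcomp s tshift) v)  (π₂ a≢b)  = tclo s (weakenVar v a≢b)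
  preservation (tlam m)                   (α₁ _)    = tlam (tclo (tcons tshift ax) m)
  preservation (tapp m n) (appL r)  = tapp (preservation m r) n
  preservation (tapp m n) (appR r)  = tapp m (preservation n r)
  preservation (tlam m)   (lamC r)  = tlam (preservation m r)
  preservation (tclo s m) (closL r) = tclo (preservationₛ s r) m
  preservation (tclo s m) (closR r) = tclo s (preservation m r)

  preservationₛ : ∀ {Γ Δ s₁ s₂} → Γ ⊢ s₁ ▷ Δ → s₁ ⟶ₛ s₂ → Γ ⊢ s₂ ▷ Δ
  preservationₛ (tcomp s (tcomp q r))      Ass       = tcomp (tcomp s q) r
  preservationₛ (tcomp s tid)              IdR       = s
  preservationₛ (tcomp tid tshift)         IdShift   = tshift
  preservationₛ (tcomp (tcons s n) tshift) ConsShift = s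
  preservationₛ (tcomp s (tcons q n))      Map       = tcons (tcomp s q) (tclo s n)
  preservationₛ (tcons s n) (consL r) = tcons (preservationₛ s r) n
  preservationₛ (tcons s n) (consR r) = tcons s (preservation n r)
  preservationₛ (tcomp s q) (compL r) = tcomp (preservationₛ s r) q
  preservationₛ (tcomp s q) (compR r) = tcomp s (preservationₛ q r)

mainTheorem1 : (∀ {Γ M₁ M₂} → Γ ⊢ M₁ → M₁ ⟶ M₂ → Γ ⊢ M₂)
    × (∀ {Γ Δ s₁ s₂} → Γ ⊢ s₁ ▷ Δ → s₁ ⟶ₛ s₂ → Γ ⊢ s₂ ▷ Δ)
mainTheorem1 = preservation ,, preservationₛ
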